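{- If $\alpha \in S \smallsetminus \{1\}$ then $\xi \alpha \in S^{\xi}$.
   Context: Let $S$ be either the Motzkin monoid $\mathscr M_n$ (planar partial Brauer monoid) or the Jones monoid $\mathscr J_n$ (planar Brauer monoid). Let $K$ be a field and fix $\xi \in K^{\times}$. For $\alpha,\beta$ in $S$, $m(\alpha,\beta)$ is the number of floating components (components lying entirely within the middle interface row) formed in computing $\alpha\beta$. $S^{\xi}$ is the twisted variant of $S$: the subsemigroup generated by $S$ in the twisted semigroup algebra over $K$, with multiplication $\xi^i \alpha \circ \xi^j \beta = \xi^{i+j+m(\alpha,\beta)}\alpha \beta$. -}

module Defs where

open import Level using (Level; suc; _⊔_)
open import Data.Nat as ℕ using (ℕ; zero)
open import Data.Fin as Fin using (Fin; toℕ)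
open import Data.Fin.Properties using () renaming (_≟_ to _≟F_)
open import Data.Bool using (Bool; true; false; _∧_; _∨_; not; if_then_else_; T)
open import Data.Maybe using (Maybe; just; nothing)
open import Data.List using (List; []; _∷_; _++_; map; filter; length; findᵇ)
open import Data.Bool.ListAction using (any; all)
open import Data.List using () renaming (allFin to allFinL)
open import Data.Product using (Σ; _×_; _,_; proj₁; proj₂; ∃)
open import Relation.Nullary using (¬_; Dec; yes; no; does)
open import Relation.Nullary.Decidable using (⌊_⌋)
open import Relation.Binary.PropositionalEquality using (_≡_; refl; cong)
open import Algebra.Bundles using (CommutativeRing)

record Field (c ℓ : Level) : Set (suc (c ⊔ ℓ)) where
  field
    commutativeRing : CommutativeRing c ℓ
  open CommutativeRing commutativeRing public
  field
    1≉0     : ¬ (1# ≈ 0#)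
    inverse : ∀ x → ¬ (x ≈ 0#) → Σ Carrier λ y → (x * y) ≈ 1#

module _ {c ℓ} (K : Field c ℓ) where
  open Field K
  pow : Carrier → ℕ → Carrier
  pow x zero      = 1#
  pow x (ℕ.suc i) = x * pow x i

data Side : Set where
  up down : Side

Point : ℕ → Set
Point n = Side × Fin n

-- A raw diagram: each point is sent to its partner (just q) or is
-- unmatched (nothing).
Diagram : ℕ → Set
Diagram n = Point n → Maybe (Point n)

_≗D_ : ∀ {n} → Diagram n → Diagram n → Set
α ≗D β = ∀ x → α x ≡ β x

flipSide : Side → Side
flipSide up   = down
flipSide down = up

idD : ∀ n → Diagram n
idD n (s , i) = just (flipSide s , i)

-- Position of a point on the boundary of the rectangle, read clockwise:
-- top 0 .. n-1 left to right, then bottom n-1 .. 0 right to left.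
pos : ∀ {n} → Point n → ℕ
pos {n} (up   , i) = toℕ i
pos {n} (down , i) = n ℕ.+ (n ℕ.∸ ℕ.suc (toℕ i))

record IsPartialBrauer {n} (α : Diagram n) : Set where
  field
    symm   : ∀ x y → α x ≡ just y → α y ≡ just x
    irrefl : ∀ x → ¬ (α x ≡ just x)

-- Planarity: no two blocks {a,b}, {c,d} cross, i.e. never
-- pos a < pos c < pos b < pos d.
Planar : ∀ {n} → Diagram n → Set
Planar α = ∀ a b c d → α a ≡ just b → α c ≡ just d →
  ¬ (pos a ℕ.< pos c × pos c ℕ.< pos b × pos b ℕ.< pos d)

Total : ∀ {n} → Diagram n → Set
Total α = ∀ x → ¬ (α x ≡ nothing)

data Kind : Set where
  motzkin jones : Kind

InS : Kind → ∀ n → Diagram n → Set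
InS motzkin n α = IsPartialBrauer α × Planar α
InS jones   n α = IsPartialBrauer α × Planar α × Total α

-- Composition αβ: stack α above β, identifying the bottom row of α with
-- the top row of β (the middle row).  Vertices of the glued graph:

data Layer : Set where
  L0 L1 L2 : Layer     -- top of α, middle row, bottom of β

_≟L_ : (a b : Layer) → Dec (a ≡ b)
L0 ≟L L0 = yes refl
L0 ≟L L1 = no λ ()
L0 ≟L L2 = no λ ()
L1 ≟L L0 = no λ ()
L1 ≟L L1 = yes refl
L1 ≟L L2 = no λ ()
L2 ≟L L0 = no λ ()
L2 ≟L L1 = no λ ()
L2 ≟L L2 = yes refl

V : ℕ → Set
V n = Layer × Fin n

_==V_ : ∀ {n} → V n → V n → Bool
(a , i) ==V (b , j) = ⌊ a ≟L b ⌋ ∧ ⌊ i ≟F j ⌋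

allV : ∀ n → List (V n)
allV n = map (L0 ,_) (allFinL n) ++ map (L1 ,_) (allFinL n) ++ map (L2 ,_) (allFinL n)

embα : ∀ {n} → Point n → V n
embα (up   , i) = (L0 , i)
embα (down , i) = (L1 , i)

embβ : ∀ {n} → Point n → V n
embβ (up   , i) = (L1 , i)
embβ (down , i) = (L2 , i)

maybeList : ∀ {A : Set} → Maybe A → List A
maybeList (just a) = a ∷ []
maybeList nothing  = []

nbrs : ∀ {n} → Diagram n → Diagram n → V n → List (V n)
nbrs α β (L0 , i) = map embα (maybeList (α (up , i)))
nbrs α β (L1 , i) = map embα (maybeList (α (down , i))) ++ map embβ (maybeList (β (up , i)))
nbrs α β (L2 , i) = map embβ (maybeList (β (down , i)))

adj : ∀ {n} → Diagram n → Diagram n → V n → V n → Bool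
adj α β u v = any (_==V v) (nbrs α β u)

step : ∀ {n} → Diagram n → Diagram n → (V n → Bool) → (V n → Bool)
step {n} α β X v = X v ∨ any (λ u → X u ∧ adj α β u v) (allV n)

iter : ∀ {A : Set} → ℕ → (A → A) → A → A
iter zero      f a = a
iter (ℕ.suc k) f a = f (iter k f a)

-- reach α β u v : v lies in the connected component of u in the glued
-- graph (3n closure steps suffice, the graph has 3n vertices).
reach : ∀ {n} → Diagram n → Diagram n → V n → V n → Bool
reach {n} α β u = iter (3 ℕ.* n) (step α β) (_==V u)

outer : ∀ {n} → V n → Bool
outer (L0 , _) = true
outer (L1 , _) = false
outer (L2 , _) = true

toPoint : ∀ {n} → V n → Point n
toPoint (L0 , i) = (up , i)
toPoint (L1 , i) = (up , i)    -- never used for middle vertices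
toPoint (L2 , i) = (down , i)

fromPoint : ∀ {n} → Point n → V n
fromPoint (up   , i) = (L0 , i)
fromPoint (down , i) = (L2 , i)

mapMaybe′ : ∀ {A B : Set} → (A → B) → Maybe A → Maybe B
mapMaybe′ f (just a) = just (f a)
mapMaybe′ f nothing  = nothing

-- The product αβ: a top/bottom point is joined to the other outer
-- vertex of its component (if any).
_·_ : ∀ {n} → Diagram n → Diagram n → Diagram n
_·_ {n} α β x =
  mapMaybe′ toPoint
    (findᵇ (λ y → outer y ∧ not (y ==V fromPoint x) ∧ reach α β (fromPoint x) y) (allV n))

-- m(α,β): the number of floating components, i.e. connected components
-- of the glued graph consisting only of middle-row vertices.  Each such
-- component is counted once, via its least middle vertex.
floatingLeader : ∀ {n} → Diagram n → Diagram n → Fin n → Bool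
floatingLeader {n} α β i =
  all (λ v → not (reach α β (L1 , i) v) ∨ not (outer v)) (allV n)
  ∧ all (λ j → not (reach α β (L1 , i) (L1 , j)) ∨ (toℕ i ℕ.≤ᵇ toℕ j)) (allFinL n)

m : ∀ {n} → Diagram n → Diagram n → ℕ
m {n} α β = length (filter (λ i → T? (floatingLeader α β i)) (allFinL n))
  where open import Relation.Nullary.Decidable using (T?)

-- An element ξ^i α of the twisted semigroup
-- algebra K S is recorded as the pair (i , α); two such pairs denote the
-- same element of K S iff the diagrams agree and ξ^i = ξ^j in K
-- (S is a K-basis of KS and ξ ≠ 0).

TW : ℕ → Set
TW n = ℕ × Diagram n

_∘ξ_ : ∀ {n} → TW n → TW n → TW n
(i , α) ∘ξ (j , β) = (i ℕ.+ j ℕ.+ m α β , α · β)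

data InSξ (k : Kind) (n : ℕ) : TW n → Set where
  gen : ∀ {α} → InS k n α → InSξ k n (0 , α)
  mul : ∀ {x y} → InSξ k n x → InSξ k n y → InSξ k n (x ∘ξ y)

ξ·∈Sξ : ∀ {c ℓ} (K : Field c ℓ) (ξ : Field.Carrier K) (k : Kind) (n : ℕ) →
        Diagram n → Set ℓ
ξ·∈Sξ K ξ k n α =
  ∃ λ (x : TW n) → InSξ k n x × (proj₂ x ≗D α) × Field._≈_ K (pow K ξ (proj₁ x)) ξ

module Submission where

-- Idea: find β ∈ S with αβ = α and m(α,β) = 1; then the product of the two
-- generators α and β of S^ξ is ξ^(0+0+1) αβ = ξα.  A planar diagram α ≠ 1
-- either has an unmatched bottom point j (only possible in the Motzkin monoid),
-- and β = f_j, the identity with strand j erased, works; or it has a bottom cup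
-- joining neighbouring points a, a+1, and β = e_a, the identity with strands a
-- and a+1 replaced by a cap and a cup, works.  In both cases the only floating
-- component is the middle copy of the defect (the point j, resp. the cup).

open import Defs
open import Level using (Level)
open import Data.Nat as ℕ using (ℕ; zero; suc; _+_; _∸_; _*_; _≤_; _<_; z≤n; s≤s)
open import Data.Nat.Properties as ℕₚ using ()
open import Data.Fin as Fin using (Fin; toℕ)
open import Data.Fin.Properties as Finₚ using () renaming (_≟_ to _≟F_)
open import Data.Fin.Induction using (<-weakInduction)
open import Data.Bool using (Bool; true; false; _∧_; _∨_; not; T)
open import Data.Bool.Properties using (T-∧; T-∨)
open import Data.Maybe using (just; nothing)
open import Data.Maybe.Properties using (just-injective)
open import Data.List using (List; []; _∷_; _++_; map; filter; length; findᵇ; tabulate)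
open import Data.List using () renaming (allFin to allFinL)
open import Data.List.Membership.Propositional using (_∈_)
open import Data.List.Properties using (filter-none)
open import Data.List.Membership.Propositional.Properties using (∈-map⁺; ∈-++⁺ˡ; ∈-++⁺ʳ; ∈-allFin; ∈-tabulate⁻)
open import Data.List.Relation.Binary.Subset.Propositional using (_⊆_)
open import Data.List.Relation.Unary.Any as Any using (Any; here; there)
open import Data.List.Relation.Unary.Any.Properties using (any⁺; any⁻)
open import Data.List.Relation.Unary.All as All using (All; []; _∷_)
open import Data.List.Relation.Unary.All.Properties using (all⁺; all⁻)
open import Data.Product using (Σ; _×_; _,_; proj₁; proj₂; ∃)
open import Data.Sum using (_⊎_; inj₁; inj₂; [_,_]; swap)
open import Data.Empty using (⊥-elim)
open import Function.Base using (_∘_)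
open import Function.Bundles using (Equivalence)
open import Relation.Nullary using (¬_; Dec; yes; no)
open import Relation.Binary.Definitions using (tri<; tri≈; tri>)
open import Relation.Nullary.Decidable using (T?; _⊎-dec_)
open import Relation.Binary.PropositionalEquality using (_≡_; _≢_; refl; cong; sym; trans; subst; subst₂)

T-not : ∀ {b} → ¬ T b → T (not b)
T-not {false} _ = _
T-not {true} ¬t = ¬t _

T-not⁻ : ∀ {b} → T (not b) → ¬ T b
T-not⁻ {false} _ ()

findᵇ-unique : ∀ {A : Set} (p : A → Bool) {xs y} → y ∈ xs → T (p y) →
  (∀ {z} → z ∈ xs → T (p z) → z ≡ y) → findᵇ p xs ≡ just y
findᵇ-unique p {x ∷ xs} y∈ py uniq with p x in eq
... | true  = cong just (uniq (here refl) (subst T (sym eq) _))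
findᵇ-unique p {x ∷ xs} (here refl) py uniq | false = ⊥-elim (subst T eq py)
findᵇ-unique p {x ∷ xs} (there y∈) py uniq | false = findᵇ-unique p y∈ py (uniq ∘ there)

findᵇ-none : ∀ {A : Set} (p : A → Bool) xs → (∀ {z} → z ∈ xs → ¬ T (p z)) → findᵇ p xs ≡ nothing
findᵇ-none p []       none = refl
findᵇ-none p (x ∷ xs) none with p x in eq
... | true  = ⊥-elim (none (here refl) (subst T (sym eq) _))
... | false = findᵇ-none p xs (none ∘ there)

count-unique : ∀ {A : Set} {k} (p : A → Bool) (f : Fin k → A) (j : Fin k) → T (p (f j)) →
  (∀ i → T (p (f i)) → i ≡ j) → length (filter (T? ∘ p) (tabulate f)) ≡ 1
count-unique {k = suc k} p f Fin.zero pj uniq with p (f Fin.zero)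
... | true  = cong suc (cong length (filter-none (T? ∘ p) (All.tabulate none)))
  where
  none : ∀ {x} → x ∈ tabulate (f ∘ Fin.suc) → ¬ T (p x)
  none x∈ px with ∈-tabulate⁻ x∈
  ... | i , refl with uniq (Fin.suc i) px
  ... | ()
... | false = ⊥-elim pj
count-unique {k = suc k} p f (Fin.suc j) pj uniq with p (f Fin.zero) in eq
... | true with uniq Fin.zero (subst T (sym eq) _)
... | ()
count-unique {k = suc k} p f (Fin.suc j) pj uniq | false =
  count-unique p (f ∘ Fin.suc) j pj (λ i pi → Finₚ.suc-injective (uniq (Fin.suc i) pi))

==V-refl : ∀ {n} (v : V n) → T (v ==V v)
==V-refl (a , i) with a ≟L a | i ≟F i
... | yes _ | yes _ = _
... | no a≢a | _ = a≢a refl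
... | yes _ | no i≢i = i≢i refl

==V-sound : ∀ {n} {u v : V n} → T (u ==V v) → u ≡ v
==V-sound {u = a , i} {b , j} eq with a ≟L b | i ≟F j
... | yes refl | yes refl = refl

∈-allV : ∀ {n} (v : V n) → v ∈ allV n
∈-allV {n} (L0 , i) = ∈-++⁺ˡ (∈-map⁺ _ (∈-allFin i))
∈-allV {n} (L1 , i) = ∈-++⁺ʳ (map (L0 ,_) (allFinL n)) (∈-++⁺ˡ (∈-map⁺ _ (∈-allFin i)))
∈-allV {n} (L2 , i) =
  ∈-++⁺ʳ (map (L0 ,_) (allFinL n)) (∈-++⁺ʳ (map (L1 ,_) (allFinL n)) (∈-map⁺ _ (∈-allFin i)))

module Glued {n} (α β : Diagram n) where

  -- A vertex set (given as a list) closed under taking neighbours contains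
  -- the whole connected component of each of its members.
  Closed : List (V n) → Set
  Closed C = ∀ {w} → w ∈ C → nbrs α β w ⊆ C

  closed-by : ∀ w {C ns} → nbrs α β w ≡ ns → All (_∈ C) ns → nbrs α β w ⊆ C
  closed-by w refl ns⊆C = All.lookup ns⊆C

  nbrs-top : ∀ {i a} → α (up , i) ≡ a → nbrs α β (L0 , i) ≡ map embα (maybeList a)
  nbrs-top refl = refl

  nbrs-mid : ∀ {i a b} → α (down , i) ≡ a → β (up , i) ≡ b →
    nbrs α β (L1 , i) ≡ map embα (maybeList a) ++ map embβ (maybeList b)
  nbrs-mid refl refl = refl

  nbrs-bot : ∀ {i b} → β (down , i) ≡ b → nbrs α β (L2 , i) ≡ map embβ (maybeList b)
  nbrs-bot refl = refl

  ∈-nbrs : ∀ w {ns v} → nbrs α β w ≡ ns → v ∈ ns → v ∈ nbrs α β w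
  ∈-nbrs w eq v∈ = subst (_ ∈_) (sym eq) v∈

  adj-complete : ∀ {w v} → v ∈ nbrs α β w → T (adj α β w v)
  adj-complete {v = v} v∈ = any⁺ _ (Any.map (λ { refl → ==V-refl v }) v∈)

  adj-sound : ∀ {w v} → T (adj α β w v) → v ∈ nbrs α β w
  adj-sound {w} adj-wv = Any.map (λ t → sym (==V-sound t)) (any⁻ _ (nbrs α β w) adj-wv)

  Seen : ℕ → V n → V n → Set
  Seen k u v = T (iter k (step α β) (_==V u) v)

  seen-closed : ∀ {C u} → u ∈ C → Closed C → ∀ k {v} → Seen k u v → v ∈ C
  seen-closed {C} u∈C cl zero seen = subst (_∈ C) (sym (==V-sound seen)) u∈C
  seen-closed {C} {u} u∈C cl (suc k) {v} seen with Equivalence.to T-∨ seen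
  ... | inj₁ earlier = seen-closed u∈C cl k earlier
  ... | inj₂ via with Any.satisfied (any⁻ _ (allV n) via)
  ... | w , w-step with Equivalence.to T-∧ w-step
  ... | seen-w , adj-wv = cl (seen-closed u∈C cl k {w} seen-w) (adj-sound {w} adj-wv)

  reach-closed : ∀ {C u v} → u ∈ C → Closed C → T (reach α β u v) → v ∈ C
  reach-closed u∈C cl = seen-closed u∈C cl (3 * n)

  seen-keep : ∀ {k u v} → Seen k u v → Seen (suc k) u v
  seen-keep seen = Equivalence.from T-∨ (inj₁ seen)

  seen-extend : ∀ {k u w v} → Seen k u w → v ∈ nbrs α β w → Seen (suc k) u v
  seen-extend {k} {u} {w} {v} seen-w v∈ =
    Equivalence.from T-∨ (inj₂ (any⁺ _ (Any.map (λ { refl → via-w }) (∈-allV w))))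
    where
    via-w : T (iter k (step α β) (_==V u) w ∧ adj α β w v)
    via-w = Equivalence.from T-∧ (seen-w , adj-complete {w} v∈)

  data Walk (u : V n) : ℕ → V n → Set where
    start  : ∀ {k} → Walk u k u
    extend : ∀ {k w v} → Walk u k w → v ∈ nbrs α β w → Walk u (suc k) v

  walk-weaken : ∀ {u k k′ v} → k ≤ k′ → Walk u k v → Walk u k′ v
  walk-weaken k≤k′ start = start
  walk-weaken (s≤s k≤k′) (extend walk v∈) = extend (walk-weaken k≤k′ walk) v∈

  walk-seen : ∀ {u k v} → Walk u k v → Seen k u v
  walk-seen {u} {zero}  start = ==V-refl u
  walk-seen {u} {suc k} start = seen-keep {k} {u} {u} (walk-seen {u} {k} start)
  walk-seen {u} {suc k} {v} (extend {w = w} walk v∈) = seen-extend {k} {u} {w} {v} (walk-seen walk) v∈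

  -- The closure runs 3n steps; walks of length 3 are short enough when n ≥ 1.
  walk-reach : ∀ {u v} → Fin n → Walk u 3 v → T (reach α β u v)
  walk-reach i walk = walk-seen (walk-weaken (ℕₚ.*-monoʳ-≤ 3 1≤n) walk)
    where
    1≤n : 1 ≤ n
    1≤n = ℕₚ.≤-trans (s≤s z≤n) (Finₚ.toℕ<n i)

  Partner : V n → V n → Bool
  Partner u y = outer y ∧ not (y ==V u) ∧ reach α β u y

  partner-in : ∀ {C u z} → u ∈ C → Closed C → T (Partner u z) → z ∈ C × T (outer z) × z ≢ u
  partner-in {C} {u} {z} u∈C cl partner with Equivalence.to T-∧ partner
  ... | outer-z , rest with Equivalence.to T-∧ rest
  ... | z≢u , reach-uz = reach-closed u∈C cl reach-uz , outer-z , T-not⁻ z≢u ∘ λ { refl → ==V-refl u }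

  product-joins : ∀ x {y C} → fromPoint x ∈ C → Closed C →
    (∀ {z} → z ∈ C → T (outer z) → z ≡ fromPoint x ⊎ z ≡ y) →
    T (outer y) → y ≢ fromPoint x → Walk (fromPoint x) 3 y → (α · β) x ≡ just (toPoint y)
  product-joins x {y} x∈C cl outers outer-y y≢x walk =
    cong (mapMaybe′ toPoint) (findᵇ-unique (Partner (fromPoint x)) (∈-allV y) partner-y only-y)
    where
    partner-y : T (Partner (fromPoint x) y)
    partner-y = Equivalence.from T-∧
      (outer-y , Equivalence.from T-∧ (T-not (y≢x ∘ ==V-sound) , walk-reach (proj₂ x) walk))
    only-y : ∀ {z} → z ∈ allV n → T (Partner (fromPoint x) z) → z ≡ y
    only-y {z} _ partner with partner-in {z = z} x∈C cl partner
    ... | z∈C , outer-z , z≢x with outers z∈C outer-z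
    ... | inj₁ z≡x = ⊥-elim (z≢x z≡x)
    ... | inj₂ z≡y = z≡y

  product-unmatched : ∀ x {C} → fromPoint x ∈ C → Closed C →
    (∀ {z} → z ∈ C → T (outer z) → z ≡ fromPoint x) → (α · β) x ≡ nothing
  product-unmatched x x∈C cl outers =
    cong (mapMaybe′ toPoint) (findᵇ-none (Partner (fromPoint x)) (allV n) no-partner)
    where
    no-partner : ∀ {z} → z ∈ allV n → ¬ T (Partner (fromPoint x) z)
    no-partner {z} _ partner with partner-in {z = z} x∈C cl partner
    ... | z∈C , outer-z , z≢x = z≢x (outers z∈C outer-z)

  floating-leader : ∀ {i C} → (L1 , i) ∈ C → Closed C → (∀ {z} → z ∈ C → ¬ T (outer z)) →
    (∀ {j} → (L1 , j) ∈ C → toℕ i ≤ toℕ j) → T (floatingLeader α β i)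
  floating-leader {i} i∈C cl inner least =
    Equivalence.from T-∧ (all⁻ _ (All.tabulate no-outer) , all⁻ _ (All.tabulate minimal))
    where
    no-outer : ∀ {v} → v ∈ allV n → T (not (reach α β (L1 , i) v) ∨ not (outer v))
    no-outer {v} _ with reach α β (L1 , i) v in reach-iv
    ... | true  = T-not (inner (reach-closed i∈C cl (subst T (sym reach-iv) _)))
    ... | false = _
    minimal : ∀ {j} → j ∈ allFinL n → T (not (reach α β (L1 , i) (L1 , j)) ∨ (toℕ i ℕ.≤ᵇ toℕ j))
    minimal {j} _ with reach α β (L1 , i) (L1 , j) in reach-ij
    ... | true  = ℕₚ.≤⇒≤ᵇ (least (reach-closed i∈C cl (subst T (sym reach-ij) _)))
    ... | false = _

  not-leader-outer : ∀ {i v} → Walk (L1 , i) 3 v → T (outer v) → ¬ T (floatingLeader α β i)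
  not-leader-outer {i} {v} walk outer-v leader
    with Equivalence.to T-∨ (All.lookup (all⁺ _ _ (proj₁ (Equivalence.to T-∧ leader))) (∈-allV v))
  ... | inj₁ unreached = T-not⁻ unreached (walk-reach i walk)
  ... | inj₂ not-outer = T-not⁻ not-outer outer-v

  not-leader-smaller : ∀ {i j} → Walk (L1 , i) 3 (L1 , j) → toℕ j < toℕ i → ¬ T (floatingLeader α β i)
  not-leader-smaller {i} {j} walk j<i leader
    with Equivalence.to T-∨ (All.lookup (all⁺ _ _ (proj₂ (Equivalence.to T-∧ leader))) (∈-allFin j))
  ... | inj₁ unreached = T-not⁻ unreached (walk-reach i walk)
  ... | inj₂ i≤j = ℕₚ.<⇒≱ j<i (ℕₚ.≤ᵇ⇒≤ (toℕ i) (toℕ j) i≤j)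

  one-floating : ∀ j → T (floatingLeader α β j) → (∀ i → T (floatingLeader α β i) → i ≡ j) →
    m α β ≡ 1
  one-floating = count-unique (floatingLeader α β) (λ i → i)

record Absorbs {n} (α β : Diagram n) : Set₁ where
  field
    B           : Fin n → Set
    B?          : ∀ i → Dec (B i)
    strand-up   : ∀ {i} → ¬ B i → β (up , i) ≡ just (down , i)
    strand-down : ∀ {i} → ¬ B i → β (down , i) ≡ just (up , i)
    copy-down   : ∀ {i} → B i → β (down , i) ≡ α (down , i)
    cups-in-B   : ∀ {i} → B i → α (down , i) ≡ nothing ⊎ ∃ λ k → B k × α (down , i) ≡ just (down , k)

module Absorption {n} {α β : Diagram n} (α-pb : IsPartialBrauer α) (abs : Absorbs α β) where
  open Glued α β
  open IsPartialBrauer α-pb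
  open Absorbs abs

  partner-in-B : ∀ {k q} → B k → α (down , k) ≡ just q → ∃ λ j → B j × q ≡ (down , j)
  partner-in-B {k} bk αk≡q with α (down , k) | cups-in-B bk
  partner-in-B bk refl | _ | inj₂ (j , bj , refl) = j , bj , refl

  top-partner-off-B : ∀ {k i} → α (down , k) ≡ just (up , i) → ¬ B k
  top-partner-off-B αk≡i bk with partner-in-B bk αk≡i
  ... | _ , _ , ()

  cup-partner-off-B : ∀ {k i} → ¬ B i → α (down , k) ≡ just (down , i) → ¬ B k
  cup-partner-off-B ¬bi αk≡i bk with partner-in-B bk αk≡i
  ... | _ , bj , refl = ¬bi bj

  strand-closed : ∀ {t b} → α (up , t) ≡ just (down , b) → ¬ B b →
    Closed ((L0 , t) ∷ (L1 , b) ∷ (L2 , b) ∷ [])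
  strand-closed αt≡b ¬bb (here refl) = closed-by (L0 , _) (nbrs-top αt≡b) (there (here refl) ∷ [])
  strand-closed αt≡b ¬bb (there (here refl)) =
    closed-by (L1 , _) (nbrs-mid (symm _ _ αt≡b) (strand-up ¬bb)) (here refl ∷ there (there (here refl)) ∷ [])
  strand-closed αt≡b ¬bb (there (there (here refl))) =
    closed-by (L2 , _) (nbrs-bot (strand-down ¬bb)) (there (here refl) ∷ [])

  absorb-top : ∀ i → (α · β) (up , i) ≡ α (up , i)
  absorb-top i with α (up , i) in αi
  ... | nothing = product-unmatched (up , i) (here refl) closed λ { (here refl) _ → refl }
    where
    closed : Closed ((L0 , i) ∷ [])
    closed (here refl) = closed-by (L0 , i) (nbrs-top αi) []
  ... | just (up , k) = product-joins (up , i) (here refl) closed outers _ (λ { refl → irrefl _ αi })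
                          (extend start (∈-nbrs (L0 , i) (nbrs-top αi) (here refl)))
    where
    closed : Closed ((L0 , i) ∷ (L0 , k) ∷ [])
    closed (here refl) = closed-by (L0 , i) (nbrs-top αi) (there (here refl) ∷ [])
    closed (there (here refl)) = closed-by (L0 , k) (nbrs-top (symm _ _ αi)) (here refl ∷ [])
    outers : ∀ {z} → z ∈ (L0 , i) ∷ (L0 , k) ∷ [] → T (outer z) → z ≡ (L0 , i) ⊎ z ≡ (L0 , k)
    outers (here refl) _ = inj₁ refl
    outers (there (here refl)) _ = inj₂ refl
  ... | just (down , k) = product-joins (up , i) (here refl) (strand-closed αi ¬bk) outers _ (λ ())
                            (extend (extend start (∈-nbrs (L0 , i) (nbrs-top αi) (here refl)))
                                    (∈-nbrs (L1 , k) (nbrs-mid (symm _ _ αi) (strand-up ¬bk)) (there (here refl))))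
    where
    ¬bk = top-partner-off-B (symm _ _ αi)
    outers : ∀ {z} → z ∈ (L0 , i) ∷ (L1 , k) ∷ (L2 , k) ∷ [] → T (outer z) →
      z ≡ (L0 , i) ⊎ z ≡ (L2 , k)
    outers (here refl) _ = inj₁ refl
    outers (there (here refl)) ()
    outers (there (there (here refl))) _ = inj₂ refl

  -- a bottom point in a B-column: β's bottom row there is α's
  absorb-bottom-B : ∀ {i} → B i → (α · β) (down , i) ≡ α (down , i)
  absorb-bottom-B {i} bi with cups-in-B bi
  ... | inj₁ αi = trans (product-unmatched (down , i) (here refl) closed λ { (here refl) _ → refl }) (sym αi)
    where
    closed : Closed ((L2 , i) ∷ [])
    closed (here refl) = closed-by (L2 , i) (nbrs-bot (trans (copy-down bi) αi)) []
  ... | inj₂ (k , bk , αi) =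
    trans (product-joins (down , i) (here refl) closed outers _ (λ { refl → irrefl _ αi })
             (extend start (∈-nbrs (L2 , i) (nbrs-bot (trans (copy-down bi) αi)) (here refl))))
          (sym αi)
    where
    closed : Closed ((L2 , i) ∷ (L2 , k) ∷ [])
    closed (here refl) = closed-by (L2 , i) (nbrs-bot (trans (copy-down bi) αi)) (there (here refl) ∷ [])
    closed (there (here refl)) = closed-by (L2 , k) (nbrs-bot (trans (copy-down bk) (symm _ _ αi))) (here refl ∷ [])
    outers : ∀ {z} → z ∈ (L2 , i) ∷ (L2 , k) ∷ [] → T (outer z) → z ≡ (L2 , i) ⊎ z ≡ (L2 , k)
    outers (here refl) _ = inj₁ refl
    outers (there (here refl)) _ = inj₂ refl

  -- a bottom point outside B: β's vertical strand leads up to α's bottom row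
  absorb-bottom-off-B : ∀ {i} → ¬ B i → (α · β) (down , i) ≡ α (down , i)
  absorb-bottom-off-B {i} ¬bi with α (down , i) in αi
  ... | nothing = product-unmatched (down , i) (here refl) closed outers
    where
    closed : Closed ((L2 , i) ∷ (L1 , i) ∷ [])
    closed (here refl) = closed-by (L2 , i) (nbrs-bot (strand-down ¬bi)) (there (here refl) ∷ [])
    closed (there (here refl)) = closed-by (L1 , i) (nbrs-mid αi (strand-up ¬bi)) (here refl ∷ [])
    outers : ∀ {z} → z ∈ (L2 , i) ∷ (L1 , i) ∷ [] → T (outer z) → z ≡ (L2 , i)
    outers (here refl) _ = refl
    outers (there (here refl)) ()
  ... | just (up , k) = product-joins (down , i) (there (there (here refl))) (strand-closed (symm _ _ αi) ¬bi)
                          outers _ (λ ())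
                          (extend (extend start (∈-nbrs (L2 , i) (nbrs-bot (strand-down ¬bi)) (here refl)))
                                  (∈-nbrs (L1 , i) (nbrs-mid αi (strand-up ¬bi)) (here refl)))
    where
    outers : ∀ {z} → z ∈ (L0 , k) ∷ (L1 , i) ∷ (L2 , i) ∷ [] → T (outer z) →
      z ≡ (L2 , i) ⊎ z ≡ (L0 , k)
    outers (here refl) _ = inj₂ refl
    outers (there (here refl)) ()
    outers (there (there (here refl))) _ = inj₁ refl
  ... | just (down , k) = product-joins (down , i) (here refl) closed outers _ (λ { refl → irrefl _ αi })
                            (extend (extend (extend start (∈-nbrs (L2 , i) (nbrs-bot (strand-down ¬bi)) (here refl)))
                                            (∈-nbrs (L1 , i) (nbrs-mid αi (strand-up ¬bi)) (here refl)))
                                    (∈-nbrs (L1 , k) (nbrs-mid (symm _ _ αi) (strand-up ¬bk)) (there (here refl))))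
    where
    ¬bk = cup-partner-off-B ¬bi (symm _ _ αi)
    C = (L2 , i) ∷ (L1 , i) ∷ (L1 , k) ∷ (L2 , k) ∷ []
    closed : Closed C
    closed (here refl) = closed-by (L2 , i) (nbrs-bot (strand-down ¬bi)) (there (here refl) ∷ [])
    closed (there (here refl)) =
      closed-by (L1 , i) (nbrs-mid αi (strand-up ¬bi)) (there (there (here refl)) ∷ here refl ∷ [])
    closed (there (there (here refl))) =
      closed-by (L1 , k) (nbrs-mid (symm _ _ αi) (strand-up ¬bk))
        (there (here refl) ∷ there (there (there (here refl))) ∷ [])
    closed (there (there (there (here refl)))) =
      closed-by (L2 , k) (nbrs-bot (strand-down ¬bk)) (there (there (here refl)) ∷ [])
    outers : ∀ {z} → z ∈ C → T (outer z) → z ≡ (L2 , i) ⊎ z ≡ (L2 , k)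
    outers (here refl) _ = inj₁ refl
    outers (there (here refl)) ()
    outers (there (there (here refl))) ()
    outers (there (there (there (here refl)))) _ = inj₂ refl

  absorb : (α · β) ≗D α
  absorb (up , i) = absorb-top i
  absorb (down , i) with B? i
  ... | yes bi = absorb-bottom-B bi
  ... | no ¬bi = absorb-bottom-off-B ¬bi

  -- Outside B the middle vertex (L1 , i) touches β's bottom row, so it leads no floating component.
  off-B-not-leader : ∀ {i} → ¬ B i → ¬ T (floatingLeader α β i)
  off-B-not-leader {i} ¬bi =
    not-leader-outer (extend start (∈-nbrs (L1 , i) (nbrs-mid refl (strand-up ¬bi)) (∈-++⁺ʳ _ (here refl)))) _

top-before-bottom : ∀ {n} (i k : Fin n) → pos {n} (up , i) < pos {n} (down , k)
top-before-bottom {n} i k = ℕₚ.<-≤-trans (Finₚ.toℕ<n i) (ℕₚ.m≤m+n n _)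

bottom-reversed : ∀ {n} {i k : Fin n} → toℕ i < toℕ k → pos {n} (down , k) < pos {n} (down , i)
bottom-reversed {n} {i} {k} i<k = ℕₚ.+-monoʳ-< n (ℕₚ.∸-monoʳ-< (s≤s i<k) (Finₚ.toℕ<n k))

∸-suc : ∀ m k → suc k ≤ m → m ∸ k ≡ suc (m ∸ suc k)
∸-suc (suc m) zero    _         = refl
∸-suc (suc m) (suc k) (s≤s k<m) = ∸-suc m k k<m

bottom-adjacent : ∀ {n} {a b : Fin n} → toℕ b ≡ suc (toℕ a) → pos {n} (down , a) ≡ suc (pos {n} (down , b))
bottom-adjacent {n} {a} {b} b≡a+1 rewrite b≡a+1 =
  trans (cong (n +_) (∸-suc n (suc (toℕ a)) (subst (_≤ n) (cong suc b≡a+1) (Finₚ.toℕ<n b)))) (ℕₚ.+-suc n _)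

flipP : ∀ {n} → Point n → Point n
flipP (s , i) = (flipSide s , i)

strands-no-cross : ∀ {n} (p r : Point n) → ¬ (pos p < pos r × pos r < pos (flipP p) × pos (flipP p) < pos (flipP r))
strands-no-cross (up , i)   (up , k)   (i<k , _ , k′<i′) = ℕₚ.<-asym k′<i′ (bottom-reversed i<k)
strands-no-cross (up , i)   (down , k) (_ , _ , k′<i′)   = ℕₚ.<-asym k′<i′ (top-before-bottom k i)
strands-no-cross (down , i) r          (i<r , r<i′ , _)  =
  ℕₚ.<-asym (ℕₚ.<-trans i<r r<i′) (top-before-bottom i i)

Adjacent : ℕ → ℕ → Set
Adjacent x y = y ≡ suc x ⊎ x ≡ suc y

nothing-between : ∀ {x y z} → Adjacent x z → ¬ (x < y × y < z)
nothing-between (inj₁ refl) (x<y , s≤s y≤x) = ℕₚ.<-irrefl refl (ℕₚ.<-≤-trans x<y y≤x)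
nothing-between (inj₂ refl) (x<y , y<z)     = ℕₚ.<-asym (ℕₚ.<-trans x<y y<z) (ℕₚ.n<1+n _)

StrandsAndShortArcs : ∀ {n} → Diagram n → Set
StrandsAndShortArcs β = ∀ p q → β p ≡ just q → q ≡ flipP p ⊎ Adjacent (pos p) (pos q)

short-arcs-planar : ∀ {n} (β : Diagram n) → StrandsAndShortArcs β → Planar β
short-arcs-planar β shape a b c d βa βc (a<c , c<b , b<d) with shape a b βa | shape c d βc
... | inj₂ a~b       | _              = nothing-between a~b (a<c , c<b)
... | inj₁ _         | inj₂ c~d       = nothing-between c~d (c<b , b<d)
... | inj₁ refl      | inj₁ refl      = strands-no-cross a c (a<c , c<b , b<d)

flipSide-involutive : ∀ s → flipSide (flipSide s) ≡ s
flipSide-involutive up   = refl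
flipSide-involutive down = refl

flipSide-≢ : ∀ s → flipSide s ≢ s
flipSide-≢ up   ()
flipSide-≢ down ()

eraseStrand : ∀ {n} → Fin n → Diagram n
eraseStrand j (s , i) with i ≟F j
... | yes _ = nothing
... | no _  = just (flipSide s , i)

module _ {n} (j : Fin n) where

  erase-at : ∀ s → eraseStrand j (s , j) ≡ nothing
  erase-at s with j ≟F j
  ... | yes _   = refl
  ... | no j≢j = ⊥-elim (j≢j refl)

  erase-off : ∀ s {i} → i ≢ j → eraseStrand j (s , i) ≡ just (flipSide s , i)
  erase-off s {i} i≢j with i ≟F j
  ... | yes i≡j = ⊥-elim (i≢j i≡j)
  ... | no _    = refl

  erase-strand : ∀ {p q} → eraseStrand j p ≡ just q → q ≡ flipP p
  erase-strand {s , i} e with i ≟F j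
  erase-strand {s , i} refl | no _ = refl

  erase-partialBrauer : IsPartialBrauer (eraseStrand j)
  erase-partialBrauer = record { symm = symmetric ; irrefl = irreflexive }
    where
    symmetric : ∀ p q → eraseStrand j p ≡ just q → eraseStrand j q ≡ just p
    symmetric (s , i) q e with i ≟F j
    symmetric (s , i) _ refl | no i≢j =
      trans (erase-off (flipSide s) i≢j) (cong (λ t → just (t , i)) (flipSide-involutive s))
    irreflexive : ∀ p → ¬ eraseStrand j p ≡ just p
    irreflexive (s , i) e = flipSide-≢ s (sym (cong proj₁ (erase-strand {s , i} e)))

  erase-planar : Planar (eraseStrand j)
  erase-planar = short-arcs-planar (eraseStrand j) (λ _ _ e → inj₁ (erase-strand e))

cupCap : ∀ {n} → Fin n → Fin n → Diagram n
cupCap a b (s , i) with i ≟F a | i ≟F b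
... | yes _ | _     = just (s , b)
... | no _  | yes _ = just (s , a)
... | no _  | no _  = just (flipSide s , i)

module CupCap {n} (a b : Fin n) (b≡a+1 : toℕ b ≡ suc (toℕ a)) where

  a≢b : a ≢ b
  a≢b refl = ℕₚ.1+n≢n (sym b≡a+1)

  at-a : ∀ s → cupCap a b (s , a) ≡ just (s , b)
  at-a s with a ≟F a
  ... | yes _   = refl
  ... | no a≢a = ⊥-elim (a≢a refl)

  at-b : ∀ s → cupCap a b (s , b) ≡ just (s , a)
  at-b s with b ≟F a | b ≟F b
  ... | yes b≡a | _      = ⊥-elim (a≢b (sym b≡a))
  ... | no _    | yes _   = refl
  ... | no _    | no b≢b = ⊥-elim (b≢b refl)

  off-ab : ∀ s {i} → i ≢ a → i ≢ b → cupCap a b (s , i) ≡ just (flipSide s , i)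
  off-ab s {i} i≢a i≢b with i ≟F a | i ≟F b
  ... | yes i≡a | _       = ⊥-elim (i≢a i≡a)
  ... | no _    | yes i≡b = ⊥-elim (i≢b i≡b)
  ... | no _    | no _    = refl

  data Column (i : Fin n) : Set where
    column-a   : i ≡ a → Column i
    column-b   : i ≡ b → Column i
    column-off : i ≢ a → i ≢ b → Column i

  column : ∀ i → Column i
  column i with i ≟F a | i ≟F b
  ... | yes i≡a | _       = column-a i≡a
  ... | no i≢a  | yes i≡b = column-b i≡b
  ... | no i≢a  | no i≢b  = column-off i≢a i≢b

  partner : ∀ s i → Column i → Point n
  partner s i (column-a _)     = (s , b)
  partner s i (column-b _)     = (s , a)
  partner s i (column-off _ _) = (flipSide s , i)

  cupCap-partner : ∀ s i (c : Column i) → cupCap a b (s , i) ≡ just (partner s i c)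
  cupCap-partner s i (column-a refl)       = at-a s
  cupCap-partner s i (column-b refl)       = at-b s
  cupCap-partner s i (column-off i≢a i≢b) = off-ab s i≢a i≢b

  cupCap-partialBrauer : IsPartialBrauer (cupCap a b)
  cupCap-partialBrauer = record { symm = symmetric ; irrefl = irreflexive }
    where
    symmetric : ∀ p q → cupCap a b p ≡ just q → cupCap a b q ≡ just p
    symmetric (s , i) q e with column i | cupCap-partner s i (column i)
    ... | column-a refl | e′ with trans (sym e′) e
    ... | refl = at-b s
    symmetric (s , i) q e | column-b refl | e′ with trans (sym e′) e
    ... | refl = at-a s
    symmetric (s , i) q e | column-off i≢a i≢b | e′ with trans (sym e′) e
    ... | refl = trans (off-ab (flipSide s) i≢a i≢b) (cong (λ t → just (t , i)) (flipSide-involutive s))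
    irreflexive : ∀ p → ¬ cupCap a b p ≡ just p
    irreflexive (s , i) e with column i | cupCap-partner s i (column i)
    ... | column-a refl | e′ = a≢b (sym (cong proj₂ (just-injective (trans (sym e′) e))))
    ... | column-b refl | e′ = a≢b (cong proj₂ (just-injective (trans (sym e′) e)))
    ... | column-off _ _ | e′ = flipSide-≢ s (cong proj₁ (just-injective (trans (sym e′) e)))

  cupCap-total : Total (cupCap a b)
  cupCap-total (s , i) e with () ← trans (sym e) (cupCap-partner s i (column i))

  ab-adjacent : ∀ s → Adjacent (pos {n} (s , a)) (pos {n} (s , b))
  ab-adjacent up   = inj₁ b≡a+1
  ab-adjacent down = inj₂ (bottom-adjacent b≡a+1)

  cupCap-shape : StrandsAndShortArcs (cupCap a b)
  cupCap-shape (s , i) q e with column i | cupCap-partner s i (column i)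
  ... | column-a refl | e′ with trans (sym e′) e
  ... | refl = inj₂ (ab-adjacent s)
  cupCap-shape (s , i) q e | column-b refl | e′ with trans (sym e′) e
  ... | refl = inj₂ (swap (ab-adjacent s))
  cupCap-shape (s , i) q e | column-off _ _ | e′ with trans (sym e′) e
  ... | refl = inj₁ refl

  cupCap-planar : Planar (cupCap a b)
  cupCap-planar = short-arcs-planar (cupCap a b) cupCap-shape

  cupCap-in-S : ∀ k → InS k n (cupCap a b)
  cupCap-in-S motzkin = cupCap-partialBrauer , cupCap-planar
  cupCap-in-S jones   = cupCap-partialBrauer , cupCap-planar , cupCap-total

module ByErasure {n} {α : Diagram n} (α-pb : IsPartialBrauer α) (j : Fin n) (αj : α (down , j) ≡ nothing) where

  absorbs : Absorbs α (eraseStrand j)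
  absorbs = record
    { B           = _≡ j
    ; B?          = _≟F j
    ; strand-up   = erase-off j up
    ; strand-down = erase-off j down
    ; copy-down   = λ { refl → trans (erase-at j down) (sym αj) }
    ; cups-in-B   = λ { refl → inj₁ αj }
    }

  open Glued α (eraseStrand j)
  open Absorption α-pb absorbs

  one-floating-component : m α (eraseStrand j) ≡ 1
  one-floating-component = one-floating j leader-j only-j
    where
    closed : Closed ((L1 , j) ∷ [])
    closed (here refl) = closed-by (L1 , j) (nbrs-mid αj (erase-at j up)) []
    leader-j : T (floatingLeader α (eraseStrand j) j)
    leader-j = floating-leader (here refl) closed (λ { (here refl) () }) λ { (here refl) → ℕₚ.≤-refl }
    only-j : ∀ i → T (floatingLeader α (eraseStrand j) i) → i ≡ j
    only-j i leader with i ≟F j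
    ... | yes i≡j = i≡j
    ... | no i≢j  = ⊥-elim (off-B-not-leader i≢j leader)

module ByCup {n} {α : Diagram n} (α-pb : IsPartialBrauer α) (a b : Fin n) (b≡a+1 : toℕ b ≡ suc (toℕ a))
  (αa : α (down , a) ≡ just (down , b)) where
  open CupCap a b b≡a+1
  open IsPartialBrauer α-pb using (symm)

  αb : α (down , b) ≡ just (down , a)
  αb = symm _ _ αa

  absorbs : Absorbs α (cupCap a b)
  absorbs = record
    { B           = λ i → i ≡ a ⊎ i ≡ b
    ; B?          = λ i → (i ≟F a) ⊎-dec (i ≟F b)
    ; strand-up   = λ ¬ab → off-ab up (¬ab ∘ inj₁) (¬ab ∘ inj₂)
    ; strand-down = λ ¬ab → off-ab down (¬ab ∘ inj₁) (¬ab ∘ inj₂)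
    ; copy-down   = λ { (inj₁ refl) → trans (at-a down) (sym αa) ; (inj₂ refl) → trans (at-b down) (sym αb) }
    ; cups-in-B   = λ { (inj₁ refl) → inj₂ (b , inj₂ refl , αa)
                      ; (inj₂ refl) → inj₂ (a , inj₁ refl , αb) }
    }

  open Glued α (cupCap a b)
  open Absorption α-pb absorbs

  one-floating-component : m α (cupCap a b) ≡ 1
  one-floating-component = one-floating a leader-a only-a
    where
    mid-a : nbrs α (cupCap a b) (L1 , a) ≡ (L1 , b) ∷ (L1 , b) ∷ []
    mid-a = nbrs-mid αa (at-a up)
    mid-b : nbrs α (cupCap a b) (L1 , b) ≡ (L1 , a) ∷ (L1 , a) ∷ []
    mid-b = nbrs-mid αb (at-b up)
    closed : Closed ((L1 , a) ∷ (L1 , b) ∷ [])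
    closed (here refl)         = closed-by (L1 , a) mid-a (there (here refl) ∷ there (here refl) ∷ [])
    closed (there (here refl)) = closed-by (L1 , b) mid-b (here refl ∷ here refl ∷ [])
    a<b : toℕ a < toℕ b
    a<b = subst (toℕ a <_) (sym b≡a+1) (ℕₚ.n<1+n _)
    leader-a : T (floatingLeader α (cupCap a b) a)
    leader-a = floating-leader (here refl) closed (λ { (here refl) () ; (there (here refl)) () })
                 λ { (here refl) → ℕₚ.≤-refl ; (there (here refl)) → ℕₚ.<⇒≤ a<b }
    only-a : ∀ i → T (floatingLeader α (cupCap a b) i) → i ≡ a
    only-a i leader with column i
    ... | column-a i≡a = i≡a
    ... | column-b refl = ⊥-elim (not-leader-smaller (extend start (∈-nbrs (L1 , b) mid-b (here refl))) a<b leader)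
    ... | column-off i≢a i≢b = ⊥-elim (off-B-not-leader [ i≢a , i≢b ] leader)

StrictlyIncreasing : ∀ {n} → (Fin n → Fin n) → Set
StrictlyIncreasing σ = ∀ {i j} → toℕ i < toℕ j → toℕ (σ i) < toℕ (σ j)

increasing-above : ∀ {n} (σ : Fin n → Fin n) → StrictlyIncreasing σ → ∀ i → toℕ i ≤ toℕ (σ i)
increasing-above {suc n} σ inc = <-weakInduction (λ i → toℕ i ≤ toℕ (σ i)) z≤n next
  where
  next : ∀ i → toℕ (Fin.inject₁ i) ≤ toℕ (σ (Fin.inject₁ i)) → suc (toℕ i) ≤ toℕ (σ (Fin.suc i))
  next i ih = ℕₚ.≤-<-trans (subst (_≤ toℕ (σ (Fin.inject₁ i))) (Finₚ.toℕ-inject₁ i) ih)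
                           (inc (subst (_< suc (toℕ i)) (sym (Finₚ.toℕ-inject₁ i)) (ℕₚ.n<1+n _)))

opposite-reverses : ∀ {n} {i j : Fin n} → toℕ i < toℕ j → toℕ (Fin.opposite j) < toℕ (Fin.opposite i)
opposite-reverses {n} {i} {j} i<j rewrite Finₚ.opposite-prop i | Finₚ.opposite-prop j =
  ℕₚ.∸-monoʳ-< (s≤s i<j) (Finₚ.toℕ<n j)

-- Conjugating by the order-reversal gives the bound from the other side.
increasing-below : ∀ {n} (σ : Fin n → Fin n) → StrictlyIncreasing σ → ∀ i → toℕ (σ i) ≤ toℕ i
increasing-below {n} σ inc i = ℕ.s≤s⁻¹ (ℕₚ.∸-cancelʳ-≤ (Finₚ.toℕ<n (σ i)) opp-bound)
  where
  τ : Fin n → Fin n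
  τ = Fin.opposite ∘ σ ∘ Fin.opposite
  τ-inc : StrictlyIncreasing τ
  τ-inc = opposite-reverses ∘ inc ∘ opposite-reverses
  opp-bound : n ∸ suc (toℕ i) ≤ n ∸ suc (toℕ (σ i))
  opp-bound = subst₂ _≤_ (Finₚ.opposite-prop i)
                (trans (cong (toℕ ∘ Fin.opposite ∘ σ) (Finₚ.opposite-involutive i)) (Finₚ.opposite-prop (σ i)))
                (increasing-above τ τ-inc (Fin.opposite i))

increasing-identity : ∀ {n} (σ : Fin n → Fin n) → StrictlyIncreasing σ → ∀ i → σ i ≡ i
increasing-identity σ inc i =
  Finₚ.toℕ-injective (ℕₚ.≤-antisym (increasing-below σ inc i) (increasing-above σ inc i))

narrower : ∀ {p q r s g} → s < q → q ≤ p + suc g → r ≡ suc p → s ≤ r + g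
narrower {p} {q} {g = g} s<q q≤p+g+1 refl =
  ℕₚ.≤-trans (ℕ.s≤s⁻¹ (ℕₚ.≤-trans s<q (subst (q ≤_) (ℕₚ.+-suc p g) q≤p+g+1))) (ℕₚ.n≤1+n _)

ShortCup : ∀ {n} → Diagram n → Set
ShortCup {n} α = Σ (Fin n) λ a → Σ (Fin n) λ b → toℕ b ≡ suc (toℕ a) × α (down , a) ≡ just (down , b)

module Planarity {n} {α : Diagram n} (α-pb : IsPartialBrauer α) (α-planar : Planar α) where
  open IsPartialBrauer α-pb

  partner-injective : ∀ {x y z} → α y ≡ just x → α z ≡ just x → y ≡ z
  partner-injective αy αz = just-injective (trans (sym (symm _ _ αy)) (symm _ _ αz))

  partner-at : ∀ {x side s t} → toℕ s ≡ toℕ t → α x ≡ just (side , s) → α x ≡ just (side , t)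
  partner-at s≡t αx rewrite Finₚ.toℕ-injective s≡t = αx

  JoinedToTop : Fin n → Set
  JoinedToTop j = ∃ λ t → α (down , j) ≡ just (up , t)

  -- If the whole bottom row is joined to the top row, the strands cannot cross,
  -- so they are vertical: α is the identity.
  all-joined-to-top : (∀ j → JoinedToTop j) → α ≗D idD n
  all-joined-to-top joined = identity
    where
    σ : Fin n → Fin n
    σ j = proj₁ (joined j)
    σ-inc : StrictlyIncreasing σ
    σ-inc {i} {j} i<j with ℕₚ.<-cmp (toℕ (σ i)) (toℕ (σ j))
    ... | tri< σi<σj _ _ = σi<σj
    ... | tri≈ _ σi≡σj _ = ⊥-elim (ℕₚ.<⇒≢ i<j (cong (toℕ ∘ proj₂)
                              (partner-injective (proj₂ (joined i)) (partner-at (sym σi≡σj) (proj₂ (joined j))))))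
    ... | tri> _ _ σj<σi = ⊥-elim (α-planar (up , σ j) (down , j) (up , σ i) (down , i)
                              (symm _ _ (proj₂ (joined j))) (symm _ _ (proj₂ (joined i)))
                              (σj<σi , top-before-bottom (σ i) j , bottom-reversed i<j))
    identity : α ≗D idD n
    identity (down , i) = partner-at (cong toℕ (increasing-identity σ σ-inc i)) (proj₂ (joined i))
    identity (up , i)   = symm _ _ (identity (down , i))

  inside-cup : ∀ {p q r x} → α (down , p) ≡ just (down , q) → toℕ p < toℕ r → toℕ r < toℕ q →
    α (down , r) ≡ just x → ∃ λ s → x ≡ (down , s) × toℕ p < toℕ s × toℕ s < toℕ q
  inside-cup {p} {q} {r} {up , t} αp p<r r<q αr = ⊥-elim (α-planar (up , t) (down , r) (down , q) (down , p)
    (symm _ _ αr) (symm _ _ αp) (top-before-bottom t q , bottom-reversed r<q , bottom-reversed p<r))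
  inside-cup {p} {q} {r} {down , s} αp p<r r<q αr with ℕₚ.<-cmp (toℕ s) (toℕ p)
  ... | tri< s<p _ _ = ⊥-elim (α-planar (down , q) (down , p) (down , r) (down , s) (symm _ _ αp) αr
                         (bottom-reversed r<q , bottom-reversed p<r , bottom-reversed s<p))
  ... | tri≈ _ s≡p _ = ⊥-elim (ℕₚ.<⇒≢ r<q (cong (toℕ ∘ proj₂)
                         (partner-injective (partner-at s≡p αr) (symm _ _ αp))))
  ... | tri> _ _ p<s with ℕₚ.<-cmp (toℕ s) (toℕ q)
  ...   | tri< s<q _ _ = s , refl , p<s , s<q
  ...   | tri≈ _ s≡q _ = ⊥-elim (ℕₚ.<⇒≢ p<r (cong (toℕ ∘ proj₂) (partner-injective αp (partner-at s≡q αr))))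
  ...   | tri> _ _ q<s = ⊥-elim (α-planar (down , s) (down , r) (down , q) (down , p) (symm _ _ αr) (symm _ _ αp)
                           (bottom-reversed q<s , bottom-reversed r<q , bottom-reversed p<r))

  cup-after : (∀ j → α (down , j) ≢ nothing) → ∀ {p q} r → toℕ r ≡ suc (toℕ p) → toℕ r < toℕ q →
    α (down , p) ≡ just (down , q) →
    ∃ λ s → toℕ r < toℕ s × toℕ s < toℕ q × α (down , r) ≡ just (down , s)
  cup-after matched {p} r r≡p+1 r<q αp with α (down , r) in αr
  ... | nothing = ⊥-elim (matched r αr)
  ... | just x with inside-cup αp (subst (toℕ p <_) (sym r≡p+1) (ℕₚ.n<1+n _)) r<q αr
  ...   | s , refl , p<s , s<q = s , r<s , s<q , refl
    where
    r≢s : r ≢ s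
    r≢s refl = irrefl _ αr
    r<s : toℕ r < toℕ s
    r<s = ℕₚ.≤∧≢⇒< (subst (_≤ toℕ s) (sym r≡p+1) p<s) (r≢s ∘ Finₚ.toℕ-injective)

  -- If no bottom point is unmatched, every bottom cup p—q contains a short cup
  -- (by descent through nested cups; g bounds the width of the cup).
  short-cup-within : (∀ j → α (down , j) ≢ nothing) → ∀ g {p q} →
    toℕ q ≤ toℕ p + g → toℕ p < toℕ q → α (down , p) ≡ just (down , q) → ShortCup α
  short-cup-within matched zero {p} q≤p p<q αp =
    ⊥-elim (ℕₚ.<-irrefl refl (ℕₚ.<-≤-trans p<q (subst (_ ≤_) (ℕₚ.+-identityʳ (toℕ p)) q≤p)))
  short-cup-within matched (suc g) {p} {q} q≤p+g p<q αp with toℕ q ℕ.≟ suc (toℕ p)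
  ... | yes q≡p+1 = p , q , q≡p+1 , αp
  ... | no q≢p+1 =
    let s , r<s , s<q , αr = cup-after matched r r≡p+1 (subst (_< toℕ q) (sym r≡p+1) p+1<q) αp
    in short-cup-within matched g (narrower s<q q≤p+g r≡p+1) r<s αr
    where
    p+1<q : suc (toℕ p) < toℕ q
    p+1<q = ℕₚ.≤∧≢⇒< p<q (q≢p+1 ∘ sym)
    r : Fin n
    r = Fin.fromℕ< (ℕₚ.<-trans p+1<q (Finₚ.toℕ<n q))
    r≡p+1 : toℕ r ≡ suc (toℕ p)
    r≡p+1 = Finₚ.toℕ-fromℕ< _

  short-cup : (∀ j → α (down , j) ≢ nothing) → ∀ {j k} → α (down , j) ≡ just (down , k) → ShortCup α
  short-cup matched {j} {k} αj with ℕₚ.<-cmp (toℕ j) (toℕ k)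
  ... | tri< j<k _ _ = short-cup-within matched (toℕ k) (ℕₚ.m≤n+m _ _) j<k αj
  ... | tri≈ _ j≡k _ = ⊥-elim (irrefl _ (partner-at (sym j≡k) αj))
  ... | tri> _ _ k<j = short-cup-within matched (toℕ j) (ℕₚ.m≤n+m _ _) k<j (symm _ _ αj)

  unmatched? : ∀ j → Dec (α (down , j) ≡ nothing)
  unmatched? j with α (down , j)
  ... | nothing = yes refl
  ... | just _  = no λ ()

  joined-to-top? : ∀ j → Dec (JoinedToTop j)
  joined-to-top? j with α (down , j)
  ... | nothing        = no λ ()
  ... | just (up , t)  = yes (t , refl)
  ... | just (down , _) = no λ ()

  bottom-partner : ∀ {j} → α (down , j) ≢ nothing → ¬ JoinedToTop j →
    ∃ λ k → α (down , j) ≡ just (down , k)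
  bottom-partner {j} matched ¬top with α (down , j)
  ... | nothing        = ⊥-elim (matched refl)
  ... | just (up , t)  = ⊥-elim (¬top (t , refl))
  ... | just (down , k) = k , refl

  non-identity : ¬ α ≗D idD n → (∃ λ j → α (down , j) ≡ nothing) ⊎ ShortCup α
  non-identity α≢1 with Finₚ.any? unmatched?
  ... | yes unmatched = inj₁ unmatched
  ... | no ¬unmatched with Finₚ.all? joined-to-top?
  ...   | yes joined = ⊥-elim (α≢1 (all-joined-to-top joined))
  ...   | no ¬joined with Finₚ.¬∀⟶∃¬ n JoinedToTop joined-to-top? ¬joined
  ...     | j , ¬top with bottom-partner (λ αj → ¬unmatched (j , αj)) ¬top
  ...       | k , αj = inj₂ (short-cup (λ i αi → ¬unmatched (i , αi)) αj)

Absorber : Kind → ∀ n → Diagram n → Set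
Absorber k n α = Σ (Diagram n) λ β → InS k n β × (α · β) ≗D α × m α β ≡ 1

erasure-absorber : ∀ {n} {α : Diagram n} j → IsPartialBrauer α → α (down , j) ≡ nothing →
  Absorber motzkin n α
erasure-absorber j α-pb αj =
  eraseStrand j , (erase-partialBrauer j , erase-planar j) ,
  Absorption.absorb α-pb (ByErasure.absorbs α-pb j αj) , ByErasure.one-floating-component α-pb j αj

cup-absorber : ∀ {n} {α : Diagram n} k → IsPartialBrauer α → ShortCup α → Absorber k n α
cup-absorber k α-pb (a , b , b≡a+1 , αa) =
  cupCap a b , CupCap.cupCap-in-S a b b≡a+1 k ,
  Absorption.absorb α-pb (ByCup.absorbs α-pb a b b≡a+1 αa) , ByCup.one-floating-component α-pb a b b≡a+1 αa

absorber : ∀ k n (α : Diagram n) → InS k n α → ¬ α ≗D idD n → Absorber k n α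
absorber motzkin n α (α-pb , α-planar) α≢1 with Planarity.non-identity α-pb α-planar α≢1
... | inj₁ (j , αj) = erasure-absorber j α-pb αj
... | inj₂ cup      = cup-absorber motzkin α-pb cup
absorber jones n α (α-pb , α-planar , α-total) α≢1 with Planarity.non-identity α-pb α-planar α≢1
... | inj₁ (j , αj) = ⊥-elim (α-total (down , j) αj)
... | inj₂ cup      = cup-absorber jones α-pb cup

lemma4p2 : ∀ {c ℓ : Level} (K : Field c ℓ) (ξ : Field.Carrier K) →
    ¬ (Field._≈_ K ξ (Field.0# K)) →
    (k : Kind) (n : ℕ) (α : Diagram n) → InS k n α →
    ¬ (α ≗D idD n) →
    ξ·∈Sξ K ξ k n α
lemma4p2 K ξ _ k n α α∈S α≢1 with absorber k n α α∈S α≢1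
... | β , β∈S , αβ≗α , m≡1 =
  (0 + 0 + m α β , α · β) , mul (gen α∈S) (gen β∈S) , αβ≗α ,
  subst (λ e → pow K ξ e ≈ ξ) (sym m≡1) (*-identityʳ ξ)
  where open Field K using (_≈_; *-identityʳ)
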